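{- Let $M$ be a finite $C$-algebra with $T,F,U$ such that $|M| > 3$ and $T$ is an atom of $M$. Then $M$ is not atomic.
   Context: A $C$-algebra is an algebra $\langle M,\vee,\wedge,\neg\rangle$ of type $(2,2,1)$ satisfying, for all $\alpha,\beta,\gamma$: $\neg\neg\alpha=\alpha$; $\neg(\alpha\wedge\beta)=\neg\alpha\vee\neg\beta$; $(\alpha\wedge\beta)\wedge\gamma=\alpha\wedge(\beta\wedge\gamma)$; $\alpha\wedge(\beta\vee\gamma)=(\alpha\wedge\beta)\vee(\alpha\wedge\gamma)$; $(\alpha\vee\beta)\wedge\gamma=(\alpha\wedge\gamma)\vee(\neg\alpha\wedge\beta\wedge\gamma)$; $\alpha\vee(\alpha\wedge\beta)=\alpha$; $(\alpha\wedge\beta)\vee(\beta\wedge\alpha)=(\beta\wedge\alpha)\vee(\alpha\wedge\beta)$. A $C$-algebra with $T,F,U$ has nullary operations $T,F,U$: $T$ is the two-sided identity for $\wedge$, $F$ the two-sided identity for $\vee$, $U$ the fixed point of $\neg$. Order: $a\leq b$ iff $a\vee b=b$. An atom is $a\neq F$ such that every $b$ with $F\leq b\leq a$, $b\neq a$ equals $F$. For finitely many atoms $a_1,\dots,a_N$: if $a_{\sigma(1)}\vee\cdots\vee a_{\sigma(N)}=a_1\vee\cdots\vee a_N$ for every bijection $\sigma$ of $\{1,\dots,N\}$, then $\bigoplus_{i=1}^N a_i$ exists and equals this value. $M$ is atomic if every $a\neq F$ in $M$ equals $\bigoplus_{i=1}^N a_i$ for some finite set of atoms $\{a_1,\dots,a_N\}$.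 -}

module Defs where

open import Level using (Level; suc; _⊔_)
open import Data.Nat using (ℕ)
open import Data.Fin using (Fin)
open import Data.Fin.Permutation using (Permutation′; _⟨$⟩ʳ_)
open import Data.Product using (Σ; _×_; ∃)
open import Relation.Binary.PropositionalEquality using (_≡_; _≢_)
open import Function.Definitions using (Injective)

record CAlgebraTFU (c : Level) : Set (suc c) where
  infixr 6 _∨_
  infixr 7 _∧_
  field
    Carrier : Set c
    _∨_ : Carrier → Carrier → Carrier
    _∧_ : Carrier → Carrier → Carrier
    ¬_  : Carrier → Carrier
    T F U : Carrier
    ¬¬-inv     : ∀ α → ¬ (¬ α) ≡ α
    deMorgan   : ∀ α β → ¬ (α ∧ β) ≡ (¬ α) ∨ (¬ β)
    ∧-assoc    : ∀ α β γ → (α ∧ β) ∧ γ ≡ α ∧ (β ∧ γ)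
    ∧-distribˡ : ∀ α β γ → α ∧ (β ∨ γ) ≡ (α ∧ β) ∨ (α ∧ γ)
    ∨∧-distribʳ : ∀ α β γ → (α ∨ β) ∧ γ ≡ (α ∧ γ) ∨ ((¬ α) ∧ β ∧ γ)
    absorb     : ∀ α β → α ∨ (α ∧ β) ≡ α
    ∧-comm-∨   : ∀ α β → (α ∧ β) ∨ (β ∧ α) ≡ (β ∧ α) ∨ (α ∧ β)
    T-identityˡ : ∀ α → T ∧ α ≡ α
    T-identityʳ : ∀ α → α ∧ T ≡ α
    F-identityˡ : ∀ α → F ∨ α ≡ α
    F-identityʳ : ∀ α → α ∨ F ≡ α
    U-fixed     : ¬ U ≡ U

module _ {c : Level} (M : CAlgebraTFU c) where
  open CAlgebraTFU M

  _≤_ : Carrier → Carrier → Set c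
  a ≤ b = a ∨ b ≡ b

  IsAtom : Carrier → Set c
  IsAtom a = a ≢ F × (∀ b → F ≤ b → b ≤ a → b ≢ a → b ≡ F)

  -- a₀ ∨ (a₁ ∨ (… ∨ a_{N-1})) ; the trailing F is harmless since F is the ∨-identity
  ⋁ : ∀ {N} → (Fin N → Carrier) → Carrier
  ⋁ {ℕ.zero}  v = F
  ⋁ {ℕ.suc N} v = v Fin.zero ∨ ⋁ (λ i → v (Fin.suc i))

  -- ⊕ of the family exists and equals x
  ⊕≡ : ∀ {N} → (Fin N → Carrier) → Carrier → Set c
  ⊕≡ {N} v x = (∀ (σ : Permutation′ N) → ⋁ (λ i → v (σ ⟨$⟩ʳ i)) ≡ ⋁ v) × ⋁ v ≡ x

  Atomic : Set c
  Atomic = ∀ a → a ≢ F →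
    ∃ λ (N : ℕ) → Σ (Fin N → Carrier) λ v →
      Injective _≡_ _≡_ v × (∀ i → IsAtom (v i)) × ⊕≡ v a

module Submission where

-- Write ∼ for the C-algebra negation.  We show that in a C-algebra
-- with T, F, U in which T is an atom and every element ≠ F is a ⊕ of atoms,
-- every element is T, F or U; a finite such algebra therefore has at most three
-- elements.
--
-- 1. Equational laws valid in every C-algebra with T, F, U: ∨ is associative,
--    T absorbs under ∨ and F under ∧, and U is the only fixed point of ∼
--    (fixed points are left zeros of both ∨ and ∧).
-- 2. Call x F-closed when x ∧ F = x.  F-closed elements are closed under ∨,
--    hence under finite joins ⋁.  An element a with a ∧ F = a ∨ T is both
--    F-closed and T-absorbing, hence a fixed point of ∼, hence a = U.
-- 3. If T is an atom, every atom other than T is F-closed (x ∧ F lies between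
--    F and x), and T cannot occur in a permutation-invariant join equal to
--    d ≠ T.  So for a ∉ {T, F} the element d = a ∨ T, written as ⊕ of atoms,
--    is F-closed; since (a ∨ T) ∧ F = a ∧ F this gives a ∧ F = a ∨ T, so a = U.
-- 4. Counting: T, F, U then enumerate M, so |M| ≤ 3.

open import Defs
open import Level using (Level)
open import Data.Nat using (ℕ; _<_)
open import Data.Fin using (Fin)
open import Function.Bundles using (_↔_)
open import Relation.Nullary using (¬_)

import Data.Nat as ℕ
open import Data.Nat.Properties using (≤⇒≯)
open import Data.Fin using (zero; suc)
open import Data.Fin.Properties using (injective⇒≤; inj⇒≟)
open import Data.Fin.Permutation using (Permutation′; _⟨$⟩ʳ_; transpose)
open import Data.Product using (∃; _,_; proj₁; proj₂)
open import Data.Empty using (⊥-elim)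
open import Relation.Nullary using (yes; no)
open import Relation.Binary.Definitions using (DecidableEquality)
open import Relation.Binary.PropositionalEquality
open import Function.Bundles using (Injection)
open import Function.Properties.Inverse using (↔⇒↣; ↔-sym)

enumerated⇒≤ : ∀ {a} {A : Set a} {m n : ℕ} (g : Fin m → A) →
  (∀ x → ∃ λ t → g t ≡ x) → Fin n ↔ A → n ℕ.≤ m
enumerated⇒≤ g g-onto bij = injective⇒≤ code-injective
  where
  open Injection (↔⇒↣ bij) using (to; injective)
  code : Fin _ → Fin _
  code k = proj₁ (g-onto (to k))
  code-injective : ∀ {k l} → code k ≡ code l → k ≡ l
  code-injective {k} {l} e = injective (begin
    to k              ≡⟨ sym (proj₂ (g-onto (to k))) ⟩
    g (code k)        ≡⟨ cong g e ⟩
    g (code l)        ≡⟨ proj₂ (g-onto (to l)) ⟩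
    to l              ∎)
    where open ≡-Reasoning

module CAlgebraLaws {c : Level} (M : CAlgebraTFU c) where
  open CAlgebraTFU M renaming (¬_ to ∼_)
  open ≡-Reasoning

  ∨-via-∧ : ∀ a b → a ∨ b ≡ ∼ (∼ a ∧ ∼ b)
  ∨-via-∧ a b = sym (trans (deMorgan (∼ a) (∼ b)) (cong₂ _∨_ (¬¬-inv a) (¬¬-inv b)))

  ∼-∨ : ∀ a b → ∼ (a ∨ b) ≡ ∼ a ∧ ∼ b
  ∼-∨ a b = trans (cong ∼_ (∨-via-∧ a b)) (¬¬-inv _)

  ∨-assoc : ∀ a b d → (a ∨ b) ∨ d ≡ a ∨ (b ∨ d)
  ∨-assoc a b d = begin
    (a ∨ b) ∨ d            ≡⟨ ∨-via-∧ _ _ ⟩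
    ∼ (∼ (a ∨ b) ∧ ∼ d)    ≡⟨ cong (λ z → ∼ (z ∧ ∼ d)) (∼-∨ a b) ⟩
    ∼ ((∼ a ∧ ∼ b) ∧ ∼ d)  ≡⟨ cong ∼_ (∧-assoc _ _ _) ⟩
    ∼ (∼ a ∧ (∼ b ∧ ∼ d))  ≡⟨ cong (λ z → ∼ (∼ a ∧ z)) (sym (∼-∨ b d)) ⟩
    ∼ (∼ a ∧ ∼ (b ∨ d))    ≡⟨ sym (∨-via-∧ _ _) ⟩
    a ∨ (b ∨ d)            ∎

  ∼T : ∼ T ≡ F
  ∼T = begin
    ∼ T              ≡⟨ sym (F-identityʳ _) ⟩
    ∼ T ∨ F          ≡⟨ cong (∼ T ∨_) (sym (¬¬-inv F)) ⟩
    ∼ T ∨ ∼ (∼ F)    ≡⟨ sym (deMorgan T (∼ F)) ⟩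
    ∼ (T ∧ ∼ F)      ≡⟨ cong ∼_ (T-identityˡ _) ⟩
    ∼ (∼ F)          ≡⟨ ¬¬-inv F ⟩
    F                ∎

  ∼F : ∼ F ≡ T
  ∼F = trans (cong ∼_ (sym ∼T)) (¬¬-inv T)

  T-zeroˡ : ∀ x → T ∨ x ≡ T
  T-zeroˡ x = trans (cong (T ∨_) (sym (T-identityˡ x))) (absorb T x)

  F-zeroˡ : ∀ x → F ∧ x ≡ F
  F-zeroˡ x = begin
    F ∧ x            ≡⟨ sym (¬¬-inv _) ⟩
    ∼ (∼ (F ∧ x))    ≡⟨ cong ∼_ (deMorgan F x) ⟩
    ∼ (∼ F ∨ ∼ x)    ≡⟨ cong (λ z → ∼ (z ∨ ∼ x)) ∼F ⟩
    ∼ (T ∨ ∼ x)      ≡⟨ cong ∼_ (T-zeroˡ _) ⟩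
    ∼ T              ≡⟨ ∼T ⟩
    F                ∎

  ∧F-∨ : ∀ x → (x ∧ F) ∨ x ≡ x
  ∧F-∨ x = begin
    (x ∧ F) ∨ x        ≡⟨ cong ((x ∧ F) ∨_) (sym (T-identityʳ x)) ⟩
    (x ∧ F) ∨ (x ∧ T)  ≡⟨ sym (∧-distribˡ x F T) ⟩
    x ∧ (F ∨ T)        ≡⟨ cong (x ∧_) (F-identityˡ T) ⟩
    x ∧ T              ≡⟨ T-identityʳ x ⟩
    x                  ∎

  ∧-pad : ∀ x γ → x ∧ γ ≡ (x ∧ γ) ∨ (∼ x ∧ F)
  ∧-pad x γ = begin
    x ∧ γ                    ≡⟨ cong (_∧ γ) (sym (F-identityʳ x)) ⟩
    (x ∨ F) ∧ γ              ≡⟨ ∨∧-distribʳ x F γ ⟩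
    (x ∧ γ) ∨ (∼ x ∧ F ∧ γ)  ≡⟨ cong (λ z → (x ∧ γ) ∨ (∼ x ∧ z)) (F-zeroˡ γ) ⟩
    (x ∧ γ) ∨ (∼ x ∧ F)      ∎

  ∨-guard : ∀ a b → a ∨ (∼ a ∧ b) ≡ a ∨ b
  ∨-guard a b = begin
    a ∨ (∼ a ∧ b)            ≡⟨ cong₂ (λ u v → u ∨ (∼ a ∧ v)) (sym (T-identityʳ a)) (sym (T-identityʳ b)) ⟩
    (a ∧ T) ∨ (∼ a ∧ b ∧ T)  ≡⟨ sym (∨∧-distribʳ a b T) ⟩
    (a ∨ b) ∧ T              ≡⟨ T-identityʳ _ ⟩
    a ∨ b                    ∎

  ∨T-∧F : ∀ a → (a ∨ T) ∧ F ≡ a ∧ F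
  ∨T-∧F a = begin
    (a ∨ T) ∧ F              ≡⟨ ∨∧-distribʳ a T F ⟩
    (a ∧ F) ∨ (∼ a ∧ T ∧ F)  ≡⟨ cong (λ z → (a ∧ F) ∨ (∼ a ∧ z)) (T-identityˡ F) ⟩
    (a ∧ F) ∨ (∼ a ∧ F)      ≡⟨ sym (∧-pad a F) ⟩
    a ∧ F                    ∎

  ∧F≡F⇒∨T≡T : ∀ x → x ∧ F ≡ F → x ∨ T ≡ T
  ∧F≡F⇒∨T≡T x e = begin
    x ∨ T            ≡⟨ ∨-via-∧ x T ⟩
    ∼ (∼ x ∧ ∼ T)    ≡⟨ cong (λ z → ∼ (∼ x ∧ z)) ∼T ⟩
    ∼ (∼ x ∧ F)      ≡⟨ cong ∼_ ∼x∧F≡F ⟩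
    ∼ F              ≡⟨ ∼F ⟩
    T                ∎
    where
    ∼x∧F≡F : ∼ x ∧ F ≡ F
    ∼x∧F≡F = begin
      ∼ x ∧ F              ≡⟨ sym (F-identityˡ _) ⟩
      F ∨ (∼ x ∧ F)        ≡⟨ cong (_∨ (∼ x ∧ F)) (sym e) ⟩
      (x ∧ F) ∨ (∼ x ∧ F)  ≡⟨ sym (∧-pad x F) ⟩
      x ∧ F                ≡⟨ e ⟩
      F                    ∎

  -- A fixed point of ∼ is a left zero of ∨ and of ∧; hence it is U.
  fixed-zero-∨ : ∀ x → ∼ x ≡ x → ∀ b → x ∨ b ≡ x
  fixed-zero-∨ x fx b = begin
    x ∨ b                    ≡⟨ sym (T-identityʳ _) ⟩
    (x ∨ b) ∧ T              ≡⟨ ∨∧-distribʳ x b T ⟩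
    (x ∧ T) ∨ (∼ x ∧ b ∧ T)  ≡⟨ cong (λ z → (x ∧ T) ∨ (z ∧ b ∧ T)) fx ⟩
    (x ∧ T) ∨ (x ∧ b ∧ T)    ≡⟨ sym (∧-distribˡ x T (b ∧ T)) ⟩
    x ∧ (T ∨ (b ∧ T))        ≡⟨ cong (x ∧_) (T-zeroˡ _) ⟩
    x ∧ T                    ≡⟨ T-identityʳ x ⟩
    x                        ∎

  fixed-zero-∧ : ∀ x → ∼ x ≡ x → ∀ b → x ∧ b ≡ x
  fixed-zero-∧ x fx b = begin
    x ∧ b            ≡⟨ sym (¬¬-inv _) ⟩
    ∼ (∼ (x ∧ b))    ≡⟨ cong ∼_ (deMorgan x b) ⟩
    ∼ (∼ x ∨ ∼ b)    ≡⟨ cong (λ z → ∼ (z ∨ ∼ b)) fx ⟩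
    ∼ (x ∨ ∼ b)      ≡⟨ cong ∼_ (fixed-zero-∨ x fx _) ⟩
    ∼ x              ≡⟨ fx ⟩
    x                ∎

  fixed⇒≡U : ∀ x → ∼ x ≡ x → x ≡ U
  fixed⇒≡U x fx = begin
    x                  ≡⟨ sym (fixed-zero-∨ x fx U) ⟩
    x ∨ U              ≡⟨ cong₂ _∨_ (sym (fixed-zero-∧ x fx U)) (sym (fixed-zero-∧ U U-fixed x)) ⟩
    (x ∧ U) ∨ (U ∧ x)  ≡⟨ ∧-comm-∨ x U ⟩
    (U ∧ x) ∨ (x ∧ U)  ≡⟨ cong₂ _∨_ (fixed-zero-∧ U U-fixed x) (fixed-zero-∧ x fx U) ⟩
    U ∨ x              ≡⟨ fixed-zero-∨ U U-fixed x ⟩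
    U                  ∎

  FClosed : Carrier → Set c
  FClosed x = x ∧ F ≡ x

  FClosed-∨ : ∀ a b → FClosed a → FClosed b → FClosed (a ∨ b)
  FClosed-∨ a b ca cb = begin
    (a ∨ b) ∧ F              ≡⟨ ∨∧-distribʳ a b F ⟩
    (a ∧ F) ∨ (∼ a ∧ b ∧ F)  ≡⟨ cong₂ (λ u v → u ∨ (∼ a ∧ v)) ca cb ⟩
    a ∨ (∼ a ∧ b)            ≡⟨ ∨-guard a b ⟩
    a ∨ b                    ∎

  FClosed-⋁ : ∀ {N} (v : Fin N → Carrier) → (∀ i → FClosed (v i)) → FClosed (⋁ M v)
  FClosed-⋁ {ℕ.zero}  v h = F-zeroˡ F
  FClosed-⋁ {ℕ.suc N} v h =
    FClosed-∨ _ _ (h zero) (FClosed-⋁ (λ i → v (suc i)) (λ i → h (suc i)))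

  -- An F-closed element absorbing T is its own negation: it equals both
  -- x ∧ ∼ x and ∼ x ∧ x, which commute under ∨.
  FClosed-absorbing⇒fixed : ∀ x → FClosed x → x ∨ T ≡ x → ∼ x ≡ x
  FClosed-absorbing⇒fixed x x∧F≡x x∨T≡x = sym (begin
    x                      ≡⟨ sym x∨∼x≡x ⟩
    x ∨ ∼ x                ≡⟨ cong₂ _∨_ (sym x∧∼x≡x) (sym ∼x∧x≡∼x) ⟩
    (x ∧ ∼ x) ∨ (∼ x ∧ x)  ≡⟨ ∧-comm-∨ x (∼ x) ⟩
    (∼ x ∧ x) ∨ (x ∧ ∼ x)  ≡⟨ cong₂ _∨_ ∼x∧x≡∼x x∧∼x≡x ⟩
    ∼ x ∨ x                ≡⟨ ∼x∨x≡∼x ⟩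
    ∼ x                    ∎)
    where
    -- y ∧ F ≡ y makes y a left zero of ∧, since F is one.
    FClosed-zeroˡ : ∀ y → FClosed y → ∀ b → y ∧ b ≡ y
    FClosed-zeroˡ y e b = begin
      y ∧ b        ≡⟨ cong (_∧ b) (sym e) ⟩
      (y ∧ F) ∧ b  ≡⟨ ∧-assoc _ _ _ ⟩
      y ∧ (F ∧ b)  ≡⟨ cong (y ∧_) (F-zeroˡ _) ⟩
      y ∧ F        ≡⟨ e ⟩
      y            ∎
    ∼x-FClosed : FClosed (∼ x)
    ∼x-FClosed = begin
      ∼ x ∧ F    ≡⟨ cong (∼ x ∧_) (sym ∼T) ⟩
      ∼ x ∧ ∼ T  ≡⟨ sym (∼-∨ x T) ⟩
      ∼ (x ∨ T)  ≡⟨ cong ∼_ x∨T≡x ⟩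
      ∼ x        ∎
    x∧∼x≡x : x ∧ ∼ x ≡ x
    x∧∼x≡x = FClosed-zeroˡ x x∧F≡x (∼ x)
    ∼x∧x≡∼x : ∼ x ∧ x ≡ ∼ x
    ∼x∧x≡∼x = FClosed-zeroˡ (∼ x) ∼x-FClosed x
    x∨∼x≡x : x ∨ ∼ x ≡ x
    x∨∼x≡x = begin
      x ∨ ∼ x              ≡⟨ ∨-via-∧ _ _ ⟩
      ∼ (∼ x ∧ ∼ (∼ x))    ≡⟨ cong (λ z → ∼ (∼ x ∧ z)) (¬¬-inv x) ⟩
      ∼ (∼ x ∧ x)          ≡⟨ cong ∼_ ∼x∧x≡∼x ⟩
      ∼ (∼ x)              ≡⟨ ¬¬-inv x ⟩
      x                    ∎
    ∼x∨x≡∼x : ∼ x ∨ x ≡ ∼ x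
    ∼x∨x≡∼x = begin
      ∼ x ∨ x              ≡⟨ ∨-via-∧ _ _ ⟩
      ∼ (∼ (∼ x) ∧ ∼ x)    ≡⟨ cong (λ z → ∼ (z ∧ ∼ x)) (¬¬-inv x) ⟩
      ∼ (x ∧ ∼ x)          ≡⟨ cong ∼_ x∧∼x≡x ⟩
      ∼ x                  ∎

  ∧F≡∨T⇒≡U : ∀ a → a ∧ F ≡ a ∨ T → a ≡ U
  ∧F≡∨T⇒≡U a e = fixed⇒≡U a (FClosed-absorbing⇒fixed a a∧F≡a a∨T≡a)
    where
    a∧F≡a : a ∧ F ≡ a
    a∧F≡a = sym (begin
      a            ≡⟨ sym (∧F-∨ a) ⟩
      (a ∧ F) ∨ a  ≡⟨ cong (_∨ a) e ⟩
      (a ∨ T) ∨ a  ≡⟨ ∨-assoc a T a ⟩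
      a ∨ (T ∨ a)  ≡⟨ cong (a ∨_) (T-zeroˡ a) ⟩
      a ∨ T        ≡⟨ sym e ⟩
      a ∧ F        ∎)
    a∨T≡a : a ∨ T ≡ a
    a∨T≡a = trans (sym e) a∧F≡a

  -- A permutation-invariant join containing T equals T (move T to the front).
  ⋁-with-T : ∀ {N} (v : Fin N → Carrier) →
    (∀ (σ : Permutation′ N) → ⋁ M (λ i → v (σ ⟨$⟩ʳ i)) ≡ ⋁ M v) →
    ∀ i → v i ≡ T → ⋁ M v ≡ T
  ⋁-with-T {ℕ.suc _} v invariant i vi≡T = begin
    ⋁ M v                                   ≡⟨ sym (invariant σ) ⟩
    v i ∨ ⋁ M (λ j → v (σ ⟨$⟩ʳ suc j))      ≡⟨ cong (_∨ ⋁ M (λ j → v (σ ⟨$⟩ʳ suc j))) vi≡T ⟩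
    T ∨ ⋁ M (λ j → v (σ ⟨$⟩ʳ suc j))        ≡⟨ T-zeroˡ _ ⟩
    T                                       ∎
    where σ = transpose zero i

  module AtomT (_≟_ : DecidableEquality Carrier) (T-atom : IsAtom M T) (atomic : Atomic M) where

    below-T : ∀ x → x ∨ T ≡ T → x ≢ T → x ≡ F
    below-T x x≤T x≢T = proj₂ T-atom x (F-identityˡ x) x≤T x≢T

    -- Every atom x ≠ T is F-closed: F ≤ x ∧ F ≤ x, and x ∧ F = F would put x below T.
    atom-FClosed : ∀ x → IsAtom M x → x ≢ T → FClosed x
    atom-FClosed x (x≢F , x-minimal) x≢T with (x ∧ F) ≟ x
    ... | yes closed = closed
    ... | no  x∧F≢x  = ⊥-elim (x≢F (below-T x (∧F≡F⇒∨T≡T x x∧F≡F) x≢T))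
      where
      x∧F≡F : x ∧ F ≡ F
      x∧F≡F = x-minimal (x ∧ F) (F-identityˡ _) (∧F-∨ x) x∧F≢x

    -- An element d ∉ {T, F} is F-closed, being a join of atoms different from T.
    FClosed-nonconstant : ∀ d → d ≢ T → d ≢ F → FClosed d
    FClosed-nonconstant d d≢T d≢F with atomic d d≢F
    ... | _ , v , _ , atoms , invariant , ⋁v≡d =
      subst FClosed ⋁v≡d (FClosed-⋁ v λ i → atom-FClosed (v i) (atoms i) (vi≢T i))
      where
      vi≢T : ∀ i → v i ≢ T
      vi≢T i vi≡T = d≢T (trans (sym ⋁v≡d) (⋁-with-T v invariant i vi≡T))

    nonconstant⇒≡U : ∀ a → a ≢ T → a ≢ F → a ≡ U
    nonconstant⇒≡U a a≢T a≢F = ∧F≡∨T⇒≡U a (trans (sym (∨T-∧F a)) d-closed)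
      where
      -- a ∨ T = F would force a ∧ F = F and hence a ∨ T = T, i.e. T = F.
      a∧F≡F : a ∨ T ≡ F → a ∧ F ≡ F
      a∧F≡F d≡F = begin
        a ∧ F        ≡⟨ sym (∨T-∧F a) ⟩
        (a ∨ T) ∧ F  ≡⟨ cong (_∧ F) d≡F ⟩
        F ∧ F        ≡⟨ F-zeroˡ F ⟩
        F            ∎
      d-closed : FClosed (a ∨ T)
      d-closed = FClosed-nonconstant (a ∨ T)
        (λ d≡T → a≢F (below-T a d≡T a≢T))
        (λ d≡F → proj₁ T-atom (trans (sym (∧F≡F⇒∨T≡T a (a∧F≡F d≡F))) d≡F))

theorem2p48 : {c : Level} (M : CAlgebraTFU c) (n : ℕ) → Fin n ↔ CAlgebraTFU.Carrier M →
    3 < n → IsAtom M (CAlgebraTFU.T M) → ¬ Atomic M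
theorem2p48 M n bij 3<n T-atom atomic = ≤⇒≯ (enumerated⇒≤ constant constant-onto bij) 3<n
  where
  open CAlgebraTFU M using (Carrier; T; F; U)
  _≟_ : DecidableEquality Carrier
  _≟_ = inj⇒≟ (↔⇒↣ (↔-sym bij))
  open CAlgebraLaws.AtomT M _≟_ T-atom atomic using (nonconstant⇒≡U)
  constant : Fin 3 → Carrier
  constant zero             = T
  constant (suc zero)       = F
  constant (suc (suc zero)) = U
  constant-onto : ∀ a → ∃ λ t → constant t ≡ a
  constant-onto a with a ≟ T | a ≟ F
  ... | yes a≡T | _       = zero , sym a≡T
  ... | no  _   | yes a≡F = suc zero , sym a≡F
  ... | no  a≢T | no  a≢F = suc (suc zero) , sym (nonconstant⇒≡U a a≢T a≢F)
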